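{- Let $d, l_1, \dotsc, l_d \in \mathbb{Z}_{\ge 1}$, $j \in \{1, \dotsc, d\}$, and suppose $l_j = u+v$ with $u, v \in \mathbb{Z}_{\ge 1}$. Then \[ K(l_1, \dotsc, l_d) \le K(l_1, \dotsc, l_{j-1}, u, v, l_{j+1}, \dotsc, l_d), \] with equality if and only if ($j = 1$ and $u = 1$) or ($j = d$ and $v = 1$).
   Context: The continuants $K_d(X_1,\dotsc,X_d)\in\mathbb{Z}[X_1,\dotsc,X_d]$ are defined by $K_0 = 1$, $K_1(X_1) = X_1$, and $K_d(X_1,\dotsc,X_d) = X_d K_{d-1}(X_1,\dotsc,X_{d-1}) + K_{d-2}(X_1,\dotsc,X_{d-2})$ for $d\ge 2$; one writes $K(X_1,\dotsc,X_d)$ for $K_d(X_1,\dotsc,X_d)$. -}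

module Defs where

open import Data.Nat using (ℕ; zero; suc; _+_; _*_)
open import Data.List using (List; []; _∷_; reverse)

-- Continuant with the recurrence peeling off the LAST variable:
-- Krev (X_d ∷ X_{d-1} ∷ ... ∷ X_1) = K_d(X_1,...,X_d).
Krev : List ℕ → ℕ
Krev [] = 1
Krev (x ∷ []) = x
Krev (x ∷ y ∷ r) = x * Krev (y ∷ r) + Krev r

K : List ℕ → ℕ
K xs = Krev (reverse xs)

{-# OPTIONS --safe #-}
-- Continuants are entries of products of the matrices [[x , 1] , [1 , 0]], so cutting a list
-- gives K (xs ++ ys) = K xs K ys + K xs⁻ K ⁻ys, where ⁻ drops the entry next to the cut. Expanding
-- both sides of the theorem this way yields the identity
--   K (pre , u + 1 , v + 1 , post) = K (pre , u + v + 2 , post) + K (pre , u) K (v , post),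
-- and for positive entries K (pre , u) vanishes only when pre is empty and u = 0, symmetrically
-- K (v , post) only when post is empty and v = 0.
module Submission where

open import Defs
open import Data.Nat using (ℕ; _+_; _≤_; _≥_; suc; _*_; s≤s; z≤n)
open import Data.Nat.Properties
  using (≤-trans; *-mono-≤; m≤m+n; m+n≡0⇒n≡0; m*n≡0⇒m≡0∨n≡0; +-cancelˡ-≡; +-identityʳ; *-identityʳ; *-zeroʳ)
open import Data.Nat.Tactic.RingSolver using (solve-∀)
open import Data.List using (List; []; _∷_; _++_; foldr; foldl; reverse)
open import Data.List.Properties using (foldl-++; reverse-foldr; reverse-++; reverse-injective)
open import Data.List.Relation.Unary.All as All using (All; []; _∷_)
import Data.List.Relation.Unary.Any.Properties as Any
open import Data.Product using (_×_; _,_; proj₁; proj₂; map₁; map₂)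
open import Data.Sum using (_⊎_; inj₁; inj₂)
import Data.Sum as Sum
open import Function using (flip; _∘_)
open import Relation.Nullary using (contradiction)
open import Function.Bundles using (_⇔_; mk⇔)
open import Relation.Binary.PropositionalEquality
  using (_≡_; refl; sym; trans; cong; cong₂; subst; module ≡-Reasoning)

-- prefixPair xs = (K xs , K xs⁻) and suffixPair ys = (K ys , K ⁻ys), with ⁻ dropping the last
-- (resp. first) entry; step x is multiplication by [[x , 1] , [1 , 0]].
step : ℕ → ℕ × ℕ → ℕ × ℕ
step x s = x * proj₁ s + proj₂ s , proj₁ s

prefixPair : List ℕ → ℕ × ℕ
prefixPair = foldl (flip step) (1 , 0)

suffixPair : List ℕ → ℕ × ℕ
suffixPair = foldr step (1 , 0)

proj₁-suffixPair : ∀ xs → proj₁ (suffixPair xs) ≡ Krev xs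
proj₁-suffixPair []           = refl
proj₁-suffixPair (x ∷ [])     = trans (+-identityʳ (x * 1)) (*-identityʳ x)
proj₁-suffixPair (x ∷ y ∷ xs) =
  cong₂ (λ m n → x * m + n) (proj₁-suffixPair (y ∷ xs)) (proj₁-suffixPair xs)

K≡proj₁-prefixPair : ∀ xs → K xs ≡ proj₁ (prefixPair xs)
K≡proj₁-prefixPair xs = begin
  Krev (reverse xs)                  ≡⟨ sym (proj₁-suffixPair (reverse xs)) ⟩
  proj₁ (suffixPair (reverse xs))    ≡⟨ cong proj₁ (reverse-foldr step (1 , 0) xs) ⟩
  proj₁ (prefixPair xs)              ∎
  where open ≡-Reasoning

proj₁-foldl-step : ∀ s ys →
  proj₁ (foldl (flip step) s ys) ≡ proj₁ s * proj₁ (suffixPair ys) + proj₂ s * proj₂ (suffixPair ys)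
proj₁-foldl-step s []       =
  sym (trans (cong₂ _+_ (*-identityʳ (proj₁ s)) (*-zeroʳ (proj₂ s))) (+-identityʳ (proj₁ s)))
proj₁-foldl-step s (y ∷ ys) =
  trans (proj₁-foldl-step (step y s) ys) (reassoc (proj₁ s) (proj₂ s) y _ _)
  where
  reassoc : ∀ p q y b b' → (y * p + q) * b + p * b' ≡ p * (y * b + b') + q * b
  reassoc = solve-∀

K-++ : ∀ xs ys →
  K (xs ++ ys) ≡ proj₁ (prefixPair xs) * proj₁ (suffixPair ys)
               + proj₂ (prefixPair xs) * proj₂ (suffixPair ys)
K-++ xs ys = begin
  K (xs ++ ys)                                   ≡⟨ K≡proj₁-prefixPair (xs ++ ys) ⟩
  proj₁ (prefixPair (xs ++ ys))                  ≡⟨ cong proj₁ (foldl-++ (flip step) (1 , 0) xs ys) ⟩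
  proj₁ (foldl (flip step) (prefixPair xs) ys)   ≡⟨ proj₁-foldl-step (prefixPair xs) ys ⟩
  _                                              ∎
  where open ≡-Reasoning

K≡Krev : ∀ xs → K xs ≡ Krev xs
K≡Krev xs = begin
  K ([] ++ xs)                                                   ≡⟨ K-++ [] xs ⟩
  1 * proj₁ (suffixPair xs) + 0 * proj₂ (suffixPair xs)          ≡⟨ +-identityʳ _ ⟩
  proj₁ (suffixPair xs) + 0                                      ≡⟨ +-identityʳ _ ⟩
  proj₁ (suffixPair xs)                                          ≡⟨ proj₁-suffixPair xs ⟩
  Krev xs                                                        ∎
  where open ≡-Reasoning

K-split : ∀ pre post u v →
  K (pre ++ suc u ∷ suc v ∷ post)
    ≡ K (pre ++ (suc u + suc v) ∷ post) + K (pre ++ u ∷ []) * K (v ∷ post)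
K-split pre post u v = begin
  K (pre ++ suc u ∷ suc v ∷ post)
    ≡⟨ K-++ pre (suc u ∷ suc v ∷ post) ⟩
  a * (suc u * (suc v * b + b') + b) + a' * (suc v * b + b')
    ≡⟨ expand u v a a' b b' ⟩
  (a * ((suc u + suc v) * b + b') + a' * b) + (a * (u * 1 + 0) + a' * 1) * (1 * (v * b + b') + 0 * b)
    ≡⟨ sym (cong₂ _+_ (K-++ pre ((suc u + suc v) ∷ post))
                      (cong₂ _*_ (K-++ pre (u ∷ [])) (K-++ [] (v ∷ post)))) ⟩
  K (pre ++ (suc u + suc v) ∷ post) + K (pre ++ u ∷ []) * K (v ∷ post)
    ∎
  where
  open ≡-Reasoning
  a  = proj₁ (prefixPair pre)
  a' = proj₂ (prefixPair pre)
  b  = proj₁ (suffixPair post)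
  b' = proj₂ (suffixPair post)
  expand : ∀ u v a a' b b' →
    a * ((1 + u) * ((1 + v) * b + b') + b) + a' * ((1 + v) * b + b')
      ≡ (a * (((1 + u) + (1 + v)) * b + b') + a' * b)
        + (a * (u * 1 + 0) + a' * 1) * (1 * (v * b + b') + 0 * b)
  expand = solve-∀

Krev-positive : ∀ {xs} → All (_≥ 1) xs → Krev xs ≥ 1
Krev-positive []                         = s≤s z≤n
Krev-positive (x≥1 ∷ [])                 = x≥1
Krev-positive (x≥1 ∷ y∷xs≥1@(_ ∷ xs≥1)) =
  ≤-trans (*-mono-≤ x≥1 (Krev-positive y∷xs≥1)) (m≤m+n _ _)

Krev-∷≡0 : ∀ {x xs} → All (_≥ 1) xs → Krev (x ∷ xs) ≡ 0 → xs ≡ [] × x ≡ 0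
Krev-∷≡0 []         Kx≡0    = refl , Kx≡0
Krev-∷≡0 (_ ∷ xs≥1) Kxyxs≡0 =
  contradiction (subst (_≥ 1) (m+n≡0⇒n≡0 _ Kxyxs≡0) (Krev-positive xs≥1)) λ ()

All-reverse : ∀ {P : ℕ → Set} {xs} → All P xs → All P (reverse xs)
All-reverse Pxs = All.tabulate (λ x∈ → All.lookup Pxs (Any.reverse⁻ x∈))

K-∷ʳ≡0 : ∀ {pre u} → All (_≥ 1) pre → K (pre ++ u ∷ []) ≡ 0 → pre ≡ [] × u ≡ 0
K-∷ʳ≡0 {pre} {u} pre≥1 K≡0 =
  map₁ reverse-injective (Krev-∷≡0 (All-reverse pre≥1) Krev≡0)
  where
  Krev≡0 : Krev (u ∷ reverse pre) ≡ 0
  Krev≡0 = trans (cong Krev (sym (reverse-++ pre (u ∷ [])))) K≡0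

K-∷≡0 : ∀ {v post} → All (_≥ 1) post → K (v ∷ post) ≡ 0 → post ≡ [] × v ≡ 0
K-∷≡0 {v} {post} post≥1 K≡0 = Krev-∷≡0 post≥1 (trans (sym (K≡Krev (v ∷ post))) K≡0)

proposition4p1 : (pre post : List ℕ) (u v : ℕ) →
    All (_≥ 1) pre → All (_≥ 1) post → u ≥ 1 → v ≥ 1 →
    (K (pre ++ (u + v) ∷ post) ≤ K (pre ++ u ∷ v ∷ post))
    × ((K (pre ++ (u + v) ∷ post) ≡ K (pre ++ u ∷ v ∷ post))
       ⇔ ((pre ≡ [] × u ≡ 1) ⊎ (post ≡ [] × v ≡ 1)))
proposition4p1 pre post (suc u) (suc v) pre≥1 post≥1 (s≤s z≤n) (s≤s z≤n) =
  subst (K merged ≤_) (sym split) (m≤m+n _ _) , mk⇔ equal⇒edge edge⇒equal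
  where
  merged : List ℕ
  merged = pre ++ (suc u + suc v) ∷ post

  split : K (pre ++ suc u ∷ suc v ∷ post) ≡ K merged + K (pre ++ u ∷ []) * K (v ∷ post)
  split = K-split pre post u v

  equal⇒edge : K merged ≡ K (pre ++ suc u ∷ suc v ∷ post) →
               (pre ≡ [] × suc u ≡ 1) ⊎ (post ≡ [] × suc v ≡ 1)
  equal⇒edge eq =
    Sum.map (map₂ (cong suc) ∘ K-∷ʳ≡0 pre≥1) (map₂ (cong suc) ∘ K-∷≡0 post≥1)
            (m*n≡0⇒m≡0∨n≡0 _ gap≡0)
    where
    gap≡0 : K (pre ++ u ∷ []) * K (v ∷ post) ≡ 0
    gap≡0 = sym (+-cancelˡ-≡ (K merged) 0 _ (trans (+-identityʳ _) (trans eq split)))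

  edge⇒equal : (pre ≡ [] × suc u ≡ 1) ⊎ (post ≡ [] × suc v ≡ 1) →
               K merged ≡ K (pre ++ suc u ∷ suc v ∷ post)
  edge⇒equal (inj₁ (refl , refl)) = sym (trans split (+-identityʳ _))
  edge⇒equal (inj₂ (refl , refl)) =
    sym (trans split (trans (cong (K merged +_) (*-zeroʳ (K (pre ++ u ∷ [])))) (+-identityʳ _)))
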